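{- For $\lambda\in\mathbb{K}$ and $a=\sum_{n\ge1}a_nX^n\in\mathbb{K}[[X]]_+$, define $$\Omega(\lambda,a)=\sum_{s\ge1}\overline{\omega}_C\Big(\sum_{n\ge1}\big[(\omega_C(a)\otimes\omega_H(\lambda))\circ\rho\big]((0,n))X^n\Big)((0,s))\,X^s .$$ Then $\Omega(\lambda,a)=a\,e^{\lambda X}$ for all $\lambda,a$. In particular $\Omega$ defines an action of the additive group $(\mathbb{K},+)$ on $\mathbb{K}[[X]]_+$, and hence (via $\omega_H,\omega_C,\overline{\omega}_C$) an action of the characters of $H$ on the characters of $C$.
   Context: $\mathbb{K}$ is a field of characteristic $0$; $\mathbb{K}[[X]]_+$ is the space of formal power series without constant term. $H=\mathbb{K}[(1)]$ is the polynomial Hopf algebra with $(1)$ primitive and $(m):=(1)^m$. $C=T\langle(0,n),n\ge1\rangle$ is the tensor algebra on the generators $(0,n)$ with basis $(0,n_1,\dots,n_q)=(0,n_1)\cdots(0,n_q)$ and each $(0,n)$ primitive. $\rho:C\to C\otimes H$ is the algebra morphism with $\rho((0,n))=\sum_{k=1}^{n-1}\binom{n}{k}(0,k)\otimes(n-k)+(0,n)\otimes1_H$. A character is an algebra morphism to $\mathbb{K}$. $\omega_H(\lambda)$ is the character of $H$ with $(1)\mapsto\lambda$; for $a=\sum a_nX^n\in\mathbb{K}[[X]]_+$, $\omega_C(a)$ is the character of $C$ with $(0,s)\mapsto s!\,a_s$ and $\overline{\omega}_C(a)$ the character of $C$ with $(0,s)\mapsto a_s/s!$. For characters $f$ of $C$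 and $g$ of $H$, $(f\otimes g)(c\otimes h)=f(c)g(h)$. -}

module Defs where

open import Level using (_⊔_)
open import Algebra.Bundles using (CommutativeRing)
open import Data.Nat as ℕ using (ℕ; zero; suc; _∸_; _!)
open import Data.Nat.Combinatorics using (_C_)
open import Data.List using (List; []; _∷_; _++_; map; concatMap; upTo; drop)
open import Data.Product using (_×_; _,_)
open import Relation.Nullary using (¬_)

-- Fields (not in agda-stdlib): a commutative ring with 0 ≠ 1 in which
-- every nonzero element has an inverse.  The inverse is a total
-- function; its value at 0 is unconstrained and never used.

record Field c ℓ : Set (Level.suc (c ⊔ ℓ)) where
  field
    commutativeRing : CommutativeRing c ℓ
  open CommutativeRing commutativeRing public
  field
    _⁻¹     : Carrier → Carrier
    inverse : ∀ x → ¬ (x ≈ 0#) → (x * (x ⁻¹)) ≈ 1#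
    0≉1     : ¬ (0# ≈ 1#)

module FieldDefs {c ℓ} (K : Field c ℓ) where
  open Field K public

  fromℕ : ℕ → Carrier
  fromℕ zero    = 0#
  fromℕ (suc n) = 1# + fromℕ n

  CharZero : Set ℓ
  CharZero = ∀ n → ¬ (fromℕ (suc n) ≈ 0#)

  _^_ : Carrier → ℕ → Carrier
  x ^ zero  = 1#
  x ^ suc m = x * (x ^ m)

  sumK : List Carrier → Carrier
  sumK []       = 0#
  sumK (x ∷ xs) = x + sumK xs

  prodK : List Carrier → Carrier
  prodK []       = 1#
  prodK (x ∷ xs) = x * prodK xs

  -- Formal power series: coefficient sequences ℕ → 𝕂 (coefficient of X^n).
  -- 𝕂[[X]]₊ = those with coefficient 0 at n = 0.
  Series : Set c
  Series = ℕ → Carrier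

  _⋆_ : Series → Series → Series
  (a ⋆ b) s = sumK (map (λ k → a k * b (s ∸ k)) (upTo (suc s)))

  expS : Carrier → Series
  expS l n = (l ^ n) * (fromℕ (n !) ⁻¹)

  -- H = 𝕂[(1)], basis (m) = (1)^m, identified with m : ℕ.
  -- C = T⟨(0,n), n ≥ 1⟩, basis words (0,n₁,…,n_q), identified with the
  -- list [n₁,…,n_q] (the empty list is 1_C).
  -- Elements of C ⊗ H: finite linear combinations of basis tensors
  -- (0,n₁,…,n_q) ⊗ (m), written as lists of (coefficient, word, m).
  Word : Set
  Word = List ℕ

  C⊗H : Set c
  C⊗H = List (Carrier × Word × ℕ)

  unitCH : C⊗H
  unitCH = (1# , [] , 0) ∷ []

  _·CH_ : C⊗H → C⊗H → C⊗H
  xs ·CH ys = concatMap (λ { (c₁ , w₁ , m₁) →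
                map (λ { (c₂ , w₂ , m₂) → (c₁ * c₂ , w₁ ++ w₂ , m₁ ℕ.+ m₂) }) ys }) xs

  ρgen : ℕ → C⊗H
  ρgen n = map (λ k → (fromℕ (n C k) , k ∷ [] , n ∸ k)) (drop 1 (upTo n))
           ++ ((1# , n ∷ [] , 0) ∷ [])

  ρ : Word → C⊗H
  ρ []      = unitCH
  ρ (n ∷ w) = ρgen n ·CH ρ w

  -- Characters.  C is free on the (0,n) and H is free on (1), so a
  -- character is determined by (any) values on the generators.
  CharC : Set c
  CharC = Word → Carrier

  CharH : Set c
  CharH = ℕ → Carrier

  charC : (ℕ → Carrier) → CharC
  charC φ w = prodK (map φ w)

  ωH : Carrier → CharH
  ωH l m = l ^ m

  ωC : Series → CharC
  ωC a = charC (λ s → fromℕ (s !) * a s)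

  ω̄C : Series → CharC
  ω̄C a = charC (λ s → a s * (fromℕ (s !) ⁻¹))

  _⊗χ_ : CharC → CharH → C⊗H → Carrier
  (f ⊗χ g) t = sumK (map (λ { (c₀ , w , m) → c₀ * (f w * g m) }) t)

  inner : Carrier → Series → Series
  inner l a zero    = 0#
  inner l a (suc n) = (ωC a ⊗χ ωH l) (ρ (suc n ∷ []))

  Ω : Carrier → Series → Series
  Ω l a zero    = 0#
  Ω l a (suc s) = ω̄C (inner l a) (suc s ∷ [])

  _≈S_ : Series → Series → Set ℓ
  a ≈S b = ∀ n → a n ≈ b n

-- Evaluating ω_C(a) ⊗ ω_H(λ) on ρ((0,n)) = Σ_{0<k<n} binom(n,k) (0,k) ⊗ (n−k) + (0,n) ⊗ 1
-- gives Σ_{1≤k≤n} binom(n,k) k! a_k λ^{n−k} = n! Σ_{1≤k≤n} a_k λ^{n−k}/(n−k)!, that is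
-- n! times the n-th coefficient of a e^{λX}; the character ω̄_C divides by n! again, so
-- Ω(λ,a) = a e^{λX}.  The action laws then come from e^{0X} = 1, the binomial theorem
-- e^{(λ+μ)X} = e^{μX} e^{λX}, and associativity of the Cauchy product.
module Submission where

open import Defs
import Algebra.Properties.CommutativeSemiring.Binomial as CommutativeSemiringBinomial
import Algebra.Properties.Semiring.Exp as SemiringExp
import Algebra.Properties.Semiring.Mult as SemiringMult
import Algebra.Properties.Semiring.Sum as SemiringSum
import Algebra.Solver.Ring.NaturalCoefficients.Default as NaturalCoefficientsSolver
open import Data.Fin using (toℕ; inject₁)
open import Data.Fin.Properties using (toℕ≤n; toℕ≤pred[n]; toℕ-inject₁; toℕ-fromℕ)
open import Data.List using ([]; _∷_; _++_; map; applyUpTo)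
open import Data.List.Properties using (map-++; map-∘; ++-identityʳ)
open import Data.Nat as ℕ using (ℕ; zero; suc; _∸_; _!; _≤_; s≤s)
open import Data.Nat.Combinatorics using (_C_; nCk≡n!/k![n-k]!; k![n∸k]!∣n!)
open import Data.Nat.DivMod using (m/n*n≡m)
import Data.Nat.Properties as ℕ
open import Data.Product using (_×_; _,_)
open import Function using (_∘_)
open import Relation.Binary.PropositionalEquality as ≡ using (_≡_)
open import Relation.Nullary using (¬_)

nCk*[k!*[n∸k]!]≡n! : ∀ {n k} → k ≤ n → (n C k) ℕ.* (k ! ℕ.* (n ∸ k) !) ≡ n !
nCk*[k!*[n∸k]!]≡n! {n} {k} k≤n = ≡.trans
  (≡.cong (ℕ._* (k ! ℕ.* (n ∸ k) !)) (nCk≡n!/k![n-k]! k≤n))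
  (m/n*n≡m {{k ℕ.!* (n ∸ k) !≢0}} (k![n∸k]!∣n! k≤n))

module _ {c ℓ} (K : Field c ℓ) where
  open FieldDefs K
  open NaturalCoefficientsSolver commutativeSemiring using (solve; _:+_; _:*_; _:=_; con)
  open SemiringSum semiring
    using (sum-syntax; sum⁺-syntax; sum-cong-≋; sum-init-last; ∑-distrib-+; *-distribˡ-sum; *-distribʳ-sum)
  module Mult = SemiringMult semiring
  module Exp = SemiringExp semiring
  module Binomial = CommutativeSemiringBinomial commutativeSemiring
  open import Relation.Binary.Reasoning.Setoid setoid

  sumK-++ : ∀ xs ys → sumK (xs ++ ys) ≈ sumK xs + sumK ys
  sumK-++ []       ys = sym (+-identityˡ _)
  sumK-++ (x ∷ xs) ys = trans (+-congˡ (sumK-++ xs ys)) (sym (+-assoc _ _ _))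

  sumK-map-applyUpTo : ∀ (f : ℕ → Carrier) (g : ℕ → ℕ) n →
                       sumK (map f (applyUpTo g n)) ≡ ∑[ i < n ] f (g (toℕ i))
  sumK-map-applyUpTo f g zero    = ≡.refl
  sumK-map-applyUpTo f g (suc n) = ≡.cong (f (g 0) +_) (sumK-map-applyUpTo f (g ∘ suc) n)

  ∑-last : ∀ (f : ℕ → Carrier) n → ∑[ i ≤ n ] f (toℕ i) ≈ ∑[ i < n ] f (toℕ i) + f n
  ∑-last f n = trans (sum-init-last {n} (f ∘ toℕ))
    (+-cong (sum-cong-≋ {n} {f ∘ toℕ ∘ inject₁} {f ∘ toℕ} (reflexive ∘ ≡.cong f ∘ toℕ-inject₁))
            (reflexive (≡.cong f (toℕ-fromℕ n))))

  fromℕ≡×1# : ∀ n → fromℕ n ≡ n Mult.× 1#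
  fromℕ≡×1# zero    = ≡.refl
  fromℕ≡×1# (suc n) = ≡.cong (1# +_) (fromℕ≡×1# n)

  fromℕ-* : ∀ m n → fromℕ (m ℕ.* n) ≈ fromℕ m * fromℕ n
  fromℕ-* m n = begin
    fromℕ (m ℕ.* n)              ≡⟨ fromℕ≡×1# (m ℕ.* n) ⟩
    (m ℕ.* n) Mult.× 1#           ≈⟨ Mult.×1-homo-* m n ⟩
    m Mult.× 1# * n Mult.× 1#     ≡⟨ ≡.cong₂ _*_ (fromℕ≡×1# m) (fromℕ≡×1# n) ⟨
    fromℕ m * fromℕ n             ∎

  ×≈fromℕ-* : ∀ n x → n Mult.× x ≈ fromℕ n * x
  ×≈fromℕ-* n x = begin
    n Mult.× x          ≈⟨ Mult.×-congʳ n (*-identityˡ x) ⟨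
    n Mult.× (1# * x)   ≈⟨ Mult.×-assoc-* n 1# x ⟨
    n Mult.× 1# * x     ≡⟨ ≡.cong (_* x) (fromℕ≡×1# n) ⟨
    fromℕ n * x         ∎

  ^≡Exp^ : ∀ x n → x ^ n ≡ x Exp.^ n
  ^≡Exp^ x zero    = ≡.refl
  ^≡Exp^ x (suc n) = ≡.cong (x *_) (^≡Exp^ x n)

  ^-congˡ : ∀ {x y} → x ≈ y → ∀ n → x ^ n ≈ y ^ n
  ^-congˡ x≈y zero    = refl
  ^-congˡ x≈y (suc n) = *-cong x≈y (^-congˡ x≈y n)

  binomial-theorem : ∀ x y n →
    (x + y) ^ n ≈ ∑[ k ≤ n ] (fromℕ (n C toℕ k) * (x ^ toℕ k * y ^ (n ∸ toℕ k)))
  binomial-theorem x y n = begin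
    (x + y) ^ n                       ≡⟨ ^≡Exp^ (x + y) n ⟩
    (x + y) Exp.^ n                   ≈⟨ Binomial.theorem n x y ⟩
    Binomial.binomialExpansion x y n  ≈⟨ sum-cong-≋ {suc n} term ⟩
    ∑[ k ≤ n ] (fromℕ (n C toℕ k) * (x ^ toℕ k * y ^ (n ∸ toℕ k))) ∎
    where
    term : ∀ k → Binomial.binomialTerm x y n k ≈ fromℕ (n C toℕ k) * (x ^ toℕ k * y ^ (n ∸ toℕ k))
    term k = trans (×≈fromℕ-* (n C toℕ k) _)
      (*-congˡ (reflexive (≡.sym (≡.cong₂ _*_ (^≡Exp^ x (toℕ k)) (^≡Exp^ y (n ∸ toℕ k))))))

  ⁻¹-unique : ∀ {x y} → x * y ≈ 1# → y ≈ x ⁻¹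
  ⁻¹-unique {x} {y} xy≈1 = begin
    y                 ≈⟨ *-identityʳ y ⟨
    y * 1#            ≈⟨ *-congˡ (inverse x x≉0) ⟨
    y * (x * x ⁻¹)    ≈⟨ solve 3 (λ y x i → y :* (x :* i) := (x :* y) :* i) refl y x (x ⁻¹) ⟩
    (x * y) * x ⁻¹    ≈⟨ *-congʳ xy≈1 ⟩
    1# * x ⁻¹         ≈⟨ *-identityˡ _ ⟩
    x ⁻¹              ∎
    where
    x≉0 : ¬ x ≈ 0#
    x≉0 x≈0 = 0≉1 (trans (sym (zeroˡ y)) (trans (*-congʳ (sym x≈0)) xy≈1))

  *-cancelʳ-⁻¹ : ∀ {x} y → ¬ x ≈ 0# → (x * y) * x ⁻¹ ≈ y
  *-cancelʳ-⁻¹ {x} y x≉0 = begin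
    (x * y) * x ⁻¹    ≈⟨ solve 3 (λ x y i → (x :* y) :* i := (x :* i) :* y) refl x y (x ⁻¹) ⟩
    (x * x ⁻¹) * y    ≈⟨ *-congʳ (inverse x x≉0) ⟩
    1# * y            ≈⟨ *-identityˡ y ⟩
    y                 ∎

  expS-zero : ∀ x → expS x 0 ≈ 1#
  expS-zero x = trans (*-identityˡ _) (sym (⁻¹-unique (trans (*-identityʳ _) (+-identityʳ 1#))))

  expS-0#-suc : ∀ n → expS 0# (suc n) ≈ 0#
  expS-0#-suc n = trans (*-congʳ (zeroˡ _)) (zeroˡ _)

  expS-cong : ∀ {x y} → x ≈ y → expS x ≈S expS y
  expS-cong x≈y n = *-congʳ (^-congˡ x≈y n)

  shift : Series → Series
  shift a n = a (suc n)

  ⋆-coefficient : ∀ a b s → (a ⋆ b) s ≡ ∑[ k ≤ s ] (a (toℕ k) * b (s ∸ toℕ k))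
  ⋆-coefficient a b s = sumK-map-applyUpTo _ (λ k → k) (suc s)

  ⋆-suc : ∀ a b s → (a ⋆ b) (suc s) ≡ a 0 * b (suc s) + (shift a ⋆ b) s
  ⋆-suc a b s = ≡.trans (⋆-coefficient a b (suc s))
    (≡.cong (a 0 * b (suc s) +_) (≡.sym (⋆-coefficient (shift a) b s)))

  ⋆-cong : ∀ {a a′ b b′} → a ≈S a′ → b ≈S b′ → (a ⋆ b) ≈S (a′ ⋆ b′)
  ⋆-cong {a} {a′} {b} {b′} a≈a′ b≈b′ s = begin
    (a ⋆ b) s
      ≡⟨ ⋆-coefficient a b s ⟩
    ∑[ k ≤ s ] (a (toℕ k) * b (s ∸ toℕ k))
      ≈⟨ sum-cong-≋ {suc s} (λ k → *-cong (a≈a′ (toℕ k)) (b≈b′ (s ∸ toℕ k))) ⟩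
    ∑[ k ≤ s ] (a′ (toℕ k) * b′ (s ∸ toℕ k))
      ≡⟨ ⋆-coefficient a′ b′ s ⟨
    (a′ ⋆ b′) s ∎

  ⋆-congˡ : ∀ {a a′} b → a ≈S a′ → (a ⋆ b) ≈S (a′ ⋆ b)
  ⋆-congˡ b a≈a′ = ⋆-cong a≈a′ (λ k → refl {b k})

  ⋆-congʳ : ∀ a {b b′} → b ≈S b′ → (a ⋆ b) ≈S (a ⋆ b′)
  ⋆-congʳ a b≈b′ = ⋆-cong (λ k → refl {a k}) b≈b′

  ⋆-distribʳ-+ : ∀ u v w s → ((λ k → u k + v k) ⋆ w) s ≈ (u ⋆ w) s + (v ⋆ w) s
  ⋆-distribʳ-+ u v w s = begin
    ((λ k → u k + v k) ⋆ w) s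
      ≡⟨ ⋆-coefficient _ w s ⟩
    ∑[ k ≤ s ] ((u (toℕ k) + v (toℕ k)) * w (s ∸ toℕ k))
      ≈⟨ sum-cong-≋ {suc s} (λ k → distribʳ (w (s ∸ toℕ k)) (u (toℕ k)) (v (toℕ k))) ⟩
    ∑[ k ≤ s ] (u (toℕ k) * w (s ∸ toℕ k) + v (toℕ k) * w (s ∸ toℕ k))
      ≈⟨ ∑-distrib-+ {suc s} (λ k → u (toℕ k) * w (s ∸ toℕ k)) (λ k → v (toℕ k) * w (s ∸ toℕ k)) ⟩
    ∑[ k ≤ s ] (u (toℕ k) * w (s ∸ toℕ k)) + ∑[ k ≤ s ] (v (toℕ k) * w (s ∸ toℕ k))
      ≡⟨ ≡.cong₂ _+_ (⋆-coefficient u w s) (⋆-coefficient v w s) ⟨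
    (u ⋆ w) s + (v ⋆ w) s ∎

  ⋆-*ˡ : ∀ x u w s → ((λ k → x * u k) ⋆ w) s ≈ x * (u ⋆ w) s
  ⋆-*ˡ x u w s = begin
    ((λ k → x * u k) ⋆ w) s
      ≡⟨ ⋆-coefficient _ w s ⟩
    ∑[ k ≤ s ] (x * u (toℕ k) * w (s ∸ toℕ k))
      ≈⟨ sum-cong-≋ {suc s} (λ k → *-assoc x (u (toℕ k)) (w (s ∸ toℕ k))) ⟩
    ∑[ k ≤ s ] (x * (u (toℕ k) * w (s ∸ toℕ k)))
      ≈⟨ *-distribˡ-sum {suc s} x (λ k → u (toℕ k) * w (s ∸ toℕ k)) ⟨
    x * ∑[ k ≤ s ] (u (toℕ k) * w (s ∸ toℕ k))
      ≡⟨ ≡.cong (x *_) (⋆-coefficient u w s) ⟨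
    x * (u ⋆ w) s ∎

  ⋆-assoc : ∀ a b w → ((a ⋆ b) ⋆ w) ≈S (a ⋆ (b ⋆ w))
  ⋆-assoc a b w zero = solve 3
    (λ x y z → (x :* y :+ con 0) :* z :+ con 0 := x :* (y :* z :+ con 0) :+ con 0) refl (a 0) (b 0) (w 0)
  ⋆-assoc a b w (suc s) = begin
    ((a ⋆ b) ⋆ w) (suc s)
      ≡⟨ ⋆-suc (a ⋆ b) w s ⟩
    (a ⋆ b) 0 * w (suc s) + (shift (a ⋆ b) ⋆ w) s
      ≈⟨ +-congˡ (⋆-congˡ w (λ k → reflexive (⋆-suc a b k)) s) ⟩
    (a ⋆ b) 0 * w (suc s) + ((λ k → a 0 * shift b k + (shift a ⋆ b) k) ⋆ w) s
      ≈⟨ +-congˡ (trans (⋆-distribʳ-+ _ _ w s) (+-congʳ (⋆-*ˡ (a 0) (shift b) w s))) ⟩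
    (a ⋆ b) 0 * w (suc s) + (a 0 * (shift b ⋆ w) s + ((shift a ⋆ b) ⋆ w) s)
      ≈⟨ +-congˡ (+-congˡ (⋆-assoc (shift a) b w s)) ⟩
    (a 0 * b 0 + 0#) * w (suc s) + (a 0 * (shift b ⋆ w) s + (shift a ⋆ (b ⋆ w)) s)
      ≈⟨ solve 5 (λ x y z u v → (x :* y :+ con 0) :* z :+ (x :* u :+ v) := x :* (y :* z :+ u) :+ v)
                 refl (a 0) (b 0) (w (suc s)) ((shift b ⋆ w) s) ((shift a ⋆ (b ⋆ w)) s) ⟩
    a 0 * (b 0 * w (suc s) + (shift b ⋆ w) s) + (shift a ⋆ (b ⋆ w)) s
      ≡⟨ ≡.cong (λ t → a 0 * t + (shift a ⋆ (b ⋆ w)) s) (⋆-suc b w s) ⟨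
    a 0 * (b ⋆ w) (suc s) + (shift a ⋆ (b ⋆ w)) s
      ≡⟨ ⋆-suc a (b ⋆ w) s ⟨
    (a ⋆ (b ⋆ w)) (suc s) ∎

  ⋆-identityʳ : ∀ e → e 0 ≈ 1# → (∀ n → e (suc n) ≈ 0#) → ∀ a → (a ⋆ e) ≈S a
  ⋆-identityʳ e e₀≈1 e₊≈0 a zero = trans (+-identityʳ _) (trans (*-congˡ e₀≈1) (*-identityʳ (a 0)))
  ⋆-identityʳ e e₀≈1 e₊≈0 a (suc s) = begin
    (a ⋆ e) (suc s)                        ≡⟨ ⋆-suc a e s ⟩
    a 0 * e (suc s) + (shift a ⋆ e) s       ≈⟨ +-cong (trans (*-congˡ (e₊≈0 s)) (zeroʳ (a 0)))
                                                      (⋆-identityʳ e e₀≈1 e₊≈0 (shift a) s) ⟩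
    0# + a (suc s)                          ≈⟨ +-identityˡ _ ⟩
    a (suc s)                               ∎

  ⊗χ-++ : ∀ (f : CharC) (g : CharH) xs ys → (f ⊗χ g) (xs ++ ys) ≈ (f ⊗χ g) xs + (f ⊗χ g) ys
  ⊗χ-++ f g xs ys = trans (reflexive (≡.cong sumK (map-++ _ xs ys)))
                          (sumK-++ (map (λ { (c₀ , w , m) → c₀ * (f w * g m) }) xs) _)

  ⊗χ-·CH-unitCH : ∀ (f : CharC) (g : CharH) t → (f ⊗χ g) (t ·CH unitCH) ≈ (f ⊗χ g) t
  ⊗χ-·CH-unitCH f g [] = refl
  ⊗χ-·CH-unitCH f g ((c₀ , w , m) ∷ t) = +-cong
    (*-cong (*-identityʳ c₀) (*-cong (reflexive (≡.cong f (++-identityʳ w)))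
                                     (reflexive (≡.cong g (ℕ.+-identityʳ m)))))
    (⊗χ-·CH-unitCH f g t)

  module _ (charZero : CharZero) where

    fromℕ-!≉0 : ∀ n → ¬ fromℕ (n !) ≈ 0#
    fromℕ-!≉0 n = ≡.subst (λ m → ¬ fromℕ m ≈ 0#) (ℕ.suc-pred (n !) {{n ℕ.!≢0}})
                          (charZero (ℕ.pred (n !)))

    fromℕ-nCk : ∀ {n k} → k ≤ n →
                fromℕ (n C k) ≈ fromℕ (n !) * (fromℕ (k !) ⁻¹ * fromℕ ((n ∸ k) !) ⁻¹)
    fromℕ-nCk {n} {k} k≤n = sym (begin
      N * (F ⁻¹ * B ⁻¹)                 ≈⟨ *-congʳ factorisation ⟩
      (Cnk * (F * B)) * (F ⁻¹ * B ⁻¹)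
        ≈⟨ solve 5 (λ c f b f′ b′ → (c :* (f :* b)) :* (f′ :* b′) := c :* ((f :* f′) :* (b :* b′)))
                   refl Cnk F B (F ⁻¹) (B ⁻¹) ⟩
      Cnk * ((F * F ⁻¹) * (B * B ⁻¹))
        ≈⟨ *-congˡ (*-cong (inverse F (fromℕ-!≉0 k)) (inverse B (fromℕ-!≉0 (n ∸ k)))) ⟩
      Cnk * (1# * 1#)                   ≈⟨ *-congˡ (*-identityˡ 1#) ⟩
      Cnk * 1#                          ≈⟨ *-identityʳ Cnk ⟩
      Cnk                               ∎)
      where
      N F B Cnk : Carrier
      N = fromℕ (n !)
      F = fromℕ (k !)
      B = fromℕ ((n ∸ k) !)
      Cnk = fromℕ (n C k)
      factorisation : N ≈ Cnk * (F * B)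
      factorisation = begin
        N                                          ≡⟨ ≡.cong fromℕ (nCk*[k!*[n∸k]!]≡n! k≤n) ⟨
        fromℕ ((n C k) ℕ.* (k ! ℕ.* (n ∸ k) !))      ≈⟨ fromℕ-* (n C k) _ ⟩
        Cnk * fromℕ (k ! ℕ.* (n ∸ k) !)            ≈⟨ *-congˡ (fromℕ-* (k !) ((n ∸ k) !)) ⟩
        Cnk * (F * B)                              ∎

    expS-+ : ∀ x y → expS (x + y) ≈S (expS x ⋆ expS y)
    expS-+ x y n = begin
      (x + y) ^ n * N ⁻¹
        ≈⟨ *-congʳ (binomial-theorem x y n) ⟩
      (∑[ k ≤ n ] (fromℕ (n C toℕ k) * (x ^ toℕ k * y ^ (n ∸ toℕ k)))) * N ⁻¹
        ≈⟨ *-distribʳ-sum {suc n} (N ⁻¹) (λ k → fromℕ (n C toℕ k) * (x ^ toℕ k * y ^ (n ∸ toℕ k))) ⟩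
      ∑[ k ≤ n ] (fromℕ (n C toℕ k) * (x ^ toℕ k * y ^ (n ∸ toℕ k)) * N ⁻¹)
        ≈⟨ sum-cong-≋ {suc n} (λ k → term (toℕ≤pred[n] k)) ⟩
      ∑[ k ≤ n ] (expS x (toℕ k) * expS y (n ∸ toℕ k))
        ≡⟨ ⋆-coefficient (expS x) (expS y) n ⟨
      (expS x ⋆ expS y) n ∎
      where
      N : Carrier
      N = fromℕ (n !)
      term : ∀ {k} → k ≤ n → fromℕ (n C k) * (x ^ k * y ^ (n ∸ k)) * N ⁻¹ ≈ expS x k * expS y (n ∸ k)
      term {k} k≤n = begin
        fromℕ (n C k) * (x ^ k * y ^ (n ∸ k)) * N ⁻¹
          ≈⟨ *-congʳ (*-congʳ (fromℕ-nCk k≤n)) ⟩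
        N * (fromℕ (k !) ⁻¹ * fromℕ ((n ∸ k) !) ⁻¹) * (x ^ k * y ^ (n ∸ k)) * N ⁻¹
          ≈⟨ solve 6 (λ m f b p q m′ → m :* (f :* b) :* (p :* q) :* m′ := (m :* m′) :* ((p :* f) :* (q :* b)))
                     refl N (fromℕ (k !) ⁻¹) (fromℕ ((n ∸ k) !) ⁻¹) (x ^ k) (y ^ (n ∸ k)) (N ⁻¹) ⟩
        (N * N ⁻¹) * (expS x k * expS y (n ∸ k))
          ≈⟨ *-congʳ (inverse N (fromℕ-!≉0 n)) ⟩
        1# * (expS x k * expS y (n ∸ k))
          ≈⟨ *-identityˡ _ ⟩
        expS x k * expS y (n ∸ k) ∎

    ρgen-term : ∀ l a {n k} → k ≤ n →
      fromℕ (n C k) * (ωC a (k ∷ []) * ωH l (n ∸ k)) ≈ fromℕ (n !) * (a k * expS l (n ∸ k))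
    ρgen-term l a {n} {k} k≤n = begin
      fromℕ (n C k) * ((F * a k * 1#) * l ^ (n ∸ k))
        ≈⟨ *-congʳ (fromℕ-nCk k≤n) ⟩
      N * (F ⁻¹ * B ⁻¹) * ((F * a k * 1#) * l ^ (n ∸ k))
        ≈⟨ solve 6 (λ m f′ b′ f u p → m :* (f′ :* b′) :* ((f :* u :* con 1) :* p) := m :* ((f :* f′) :* (u :* (p :* b′))))
                   refl N (F ⁻¹) (B ⁻¹) F (a k) (l ^ (n ∸ k)) ⟩
      N * ((F * F ⁻¹) * (a k * expS l (n ∸ k)))
        ≈⟨ *-congˡ (*-congʳ (inverse F (fromℕ-!≉0 k))) ⟩
      N * (1# * (a k * expS l (n ∸ k)))
        ≈⟨ *-congˡ (*-identityˡ _) ⟩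
      N * (a k * expS l (n ∸ k)) ∎
      where
      N F B : Carrier
      N = fromℕ (n !)
      F = fromℕ (k !)
      B = fromℕ ((n ∸ k) !)

    ωC⊗ωH-ρgen : ∀ l a s → (ωC a ⊗χ ωH l) (ρgen (suc s)) ≈ fromℕ (suc s !) * (shift a ⋆ expS l) s
    ωC⊗ωH-ρgen l a s = begin
      (f ⊗χ g) (ρgen n)
        ≈⟨ ⊗χ-++ f g (map summand (applyUpTo suc s)) _ ⟩
      (f ⊗χ g) (map summand (applyUpTo suc s)) + L
        ≡⟨ ≡.cong (_+ L) (≡.trans (≡.cong sumK (≡.sym (map-∘ (applyUpTo suc s))))
                                  (sumK-map-applyUpTo _ suc s)) ⟩
      ∑[ j < s ] (fromℕ (n C suc (toℕ j)) * (f (suc (toℕ j) ∷ []) * g (s ∸ toℕ j)))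
        + L
        ≈⟨ +-cong (sum-cong-≋ {s} (λ j → ρgen-term l a (s≤s (toℕ≤n j)))) last ⟩
      ∑[ j < s ] t (toℕ j) + t s
        ≈⟨ ∑-last t s ⟨
      ∑[ j ≤ s ] (N * (shift a (toℕ j) * expS l (s ∸ toℕ j)))
        ≈⟨ *-distribˡ-sum {suc s} N (λ j → shift a (toℕ j) * expS l (s ∸ toℕ j)) ⟨
      N * ∑[ j ≤ s ] (shift a (toℕ j) * expS l (s ∸ toℕ j))
        ≡⟨ ≡.cong (N *_) (⋆-coefficient (shift a) (expS l) s) ⟨
      N * (shift a ⋆ expS l) s ∎
      where
      n : ℕ
      n = suc s
      N : Carrier
      N = fromℕ (n !)
      f : CharC
      f = ωC a
      g : CharH
      g = ωH l
      summand : ℕ → Carrier × Word × ℕ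
      summand k = fromℕ (n C k) , k ∷ [] , n ∸ k
      t : ℕ → Carrier
      t j = N * (shift a j * expS l (s ∸ j))
      L : Carrier
      L = 1# * (f (n ∷ []) * g 0) + 0#
      last : L ≈ t s
      last = begin
        1# * ((N * a n * 1#) * 1#) + 0#
          ≈⟨ solve 2 (λ m u → con 1 :* ((m :* u :* con 1) :* con 1) :+ con 0 := m :* (u :* con 1)) refl N (a n) ⟩
        N * (a n * 1#)                 ≈⟨ *-congˡ (*-congˡ (expS-zero l)) ⟨
        N * (a n * expS l 0)           ≡⟨ ≡.cong (λ m → N * (a n * expS l m)) (ℕ.n∸n≡0 s) ⟨
        t s                            ∎

    Ω≈⋆expS : ∀ l a → a 0 ≈ 0# → Ω l a ≈S (a ⋆ expS l)
    Ω≈⋆expS l a a₀≈0 zero = sym (trans (+-identityʳ _) (trans (*-congʳ a₀≈0) (zeroˡ _)))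
    Ω≈⋆expS l a a₀≈0 (suc s) = begin
      (inner l a (suc s) * N ⁻¹) * 1#               ≈⟨ *-identityʳ _ ⟩
      inner l a (suc s) * N ⁻¹                      ≈⟨ *-congʳ (⊗χ-·CH-unitCH (ωC a) (ωH l) (ρgen (suc s))) ⟩
      (ωC a ⊗χ ωH l) (ρgen (suc s)) * N ⁻¹          ≈⟨ *-congʳ (ωC⊗ωH-ρgen l a s) ⟩
      (N * (shift a ⋆ expS l) s) * N ⁻¹             ≈⟨ *-cancelʳ-⁻¹ _ (fromℕ-!≉0 (suc s)) ⟩
      (shift a ⋆ expS l) s                          ≈⟨ +-identityˡ _ ⟨
      0# + (shift a ⋆ expS l) s                     ≈⟨ +-congʳ (trans (*-congʳ a₀≈0) (zeroˡ _)) ⟨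
      a 0 * expS l (suc s) + (shift a ⋆ expS l) s   ≡⟨ ⋆-suc a (expS l) s ⟨
      (a ⋆ expS l) (suc s)                          ∎
      where
      N : Carrier
      N = fromℕ (suc s !)

    Ω-identity : ∀ a → a 0 ≈ 0# → Ω 0# a ≈S a
    Ω-identity a a₀≈0 n =
      trans (Ω≈⋆expS 0# a a₀≈0 n) (⋆-identityʳ (expS 0#) (expS-zero 0#) expS-0#-suc a n)

    Ω-homo-+ : ∀ l m a → a 0 ≈ 0# → Ω (l + m) a ≈S Ω l (Ω m a)
    Ω-homo-+ l m a a₀≈0 n = begin
      Ω (l + m) a n               ≈⟨ Ω≈⋆expS (l + m) a a₀≈0 n ⟩
      (a ⋆ expS (l + m)) n        ≈⟨ ⋆-congʳ a (λ k → trans (expS-cong (+-comm l m) k) (expS-+ m l k)) n ⟩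
      (a ⋆ (expS m ⋆ expS l)) n   ≈⟨ ⋆-assoc a (expS m) (expS l) n ⟨
      ((a ⋆ expS m) ⋆ expS l) n   ≈⟨ ⋆-congˡ (expS l) (λ k → sym (Ω≈⋆expS m a a₀≈0 k)) n ⟩
      (Ω m a ⋆ expS l) n          ≈⟨ Ω≈⋆expS l (Ω m a) refl n ⟨
      Ω l (Ω m a) n               ∎

mainTheorem15 : ∀ {c ℓ} (K : Field c ℓ) → FieldDefs.CharZero K →
    let open FieldDefs K in
    (∀ (l : Carrier) (a : Series) → a 0 ≈ 0# → Ω l a ≈S (a ⋆ expS l))
    × (∀ (a : Series) → a 0 ≈ 0# → Ω 0# a ≈S a)
    × (∀ (l m : Carrier) (a : Series) → a 0 ≈ 0# → Ω (l + m) a ≈S Ω l (Ω m a))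
mainTheorem15 K charZero = Ω≈⋆expS K charZero , Ω-identity K charZero , Ω-homo-+ K charZero
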